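{- Let $p$ be an integer with $p\geq 3$. For every integer $n$ with $n\geq p+2$, $\mathrm{conv}^{\leq p}(DW_n) \geq \frac{p-1}{(p-2)^2+1}\cdot (n-2)$.
   Context: For $n\geq 5$, the double wheel $DW_n$ is the graph obtained from a cycle of order $n-2$ by adding two new (non-adjacent) vertices, each adjacent to all vertices of the cycle. In an oriented graph, the inversion of a vertex set $X$ reverses the orientation of every arc with both endvertices in $X$; a $(\leq p)$-inversion is the inversion of a set of at most $p$ vertices. For a graph $G$, $\mathrm{conv}^{\leq p}(G)$ is the minimum number of $(\leq p)$-inversions transforming an orientation of $G$ into its converse (all arcs reversed); this does not depend on the chosen orientation. -}

module Defs where

open import Data.Bool using (Bool; true; false; _∧_; _∨_; not; if_then_else_)
open import Data.Bool using () renaming (_xor_ to _⊕_)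
open import Data.Nat using (ℕ; zero; suc; _≡ᵇ_; _<ᵇ_; _∸_)
open import Data.Fin using (Fin; toℕ)
open import Data.Fin.Subset using (Subset)
open import Data.Vec using (lookup)
open import Data.List using (List; foldl)
open import Relation.Binary.PropositionalEquality using (_≡_)

Graph : ℕ → Set
Graph n = Fin n → Fin n → Bool

cycAdj : ℕ → ℕ → ℕ → Bool
cycAdj m a b =
  (suc a ≡ᵇ b) ∨ (suc b ≡ᵇ a)
  ∨ ((a ≡ᵇ 0) ∧ (suc b ≡ᵇ m))
  ∨ ((b ≡ᵇ 0) ∧ (suc a ≡ᵇ m))

-- The double wheel DW_n on vertices Fin n: vertices 0,…,n-3 form a cycle
-- of order n-2; vertices n-2 and n-1 are the two (non-adjacent) hubs,
-- each adjacent to all cycle vertices.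
DW : (n : ℕ) → Graph n
DW n u v with toℕ u <ᵇ (n ∸ 2) | toℕ v <ᵇ (n ∸ 2)
... | true  | true  = cycAdj (n ∸ 2) (toℕ u) (toℕ v)
... | true  | false = true
... | false | true  = true
... | false | false = false

record Orientation (n : ℕ) (G : Graph n) : Set where
  field
    arc      : Fin n → Fin n → Bool
    edge-one : ∀ u v → G u v ≡ true → arc u v ⊕ arc v u ≡ true
    non-edge : ∀ u v → G u v ≡ false → arc u v ≡ false
open Orientation public

invert : {n : ℕ} → Subset n → (Fin n → Fin n → Bool) → (Fin n → Fin n → Bool)
invert X a u v = if lookup X u ∧ lookup X v then a v u else a u v

invertAll : {n : ℕ} → List (Subset n) → (Fin n → Fin n → Bool) → (Fin n → Fin n → Bool)
invertAll Xs a = foldl (λ b X → invert X b) a Xs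

{-# OPTIONS --safe #-}
module Submission where

-- Every edge of DW_n lies in some inverted set: an arc that is never inverted
-- keeps its direction.  Give the 2(n − 2) spokes weight 1 and the n − 2 rim
-- edges weight p − 3, for a total of (p − 1)(n − 2).  A set of at most p
-- vertices with h hubs and c rim vertices contains h·c spokes, and at most
-- c − 1 rim edges unless it contains the whole rim, because a proper subset of
-- a cycle induces a disjoint union of paths.  Since h + c ≤ p, this bounds the
-- weight inside each inverted set by (p − 2)² + 1.  A set containing the whole
-- rim forces n = p + 2 and is then exactly the rim, of weight p(p − 3), which
-- exceeds that bound only when p ≥ 6.  In that case at least two inversions
-- are needed (a single one would contain every vertex, as no vertex is
-- isolated), and (p − 1)p ≤ 2((p − 2)² + 1) holds for p ≥ 5.

open import Defs
open import Data.Nat using (ℕ; _≤_; _+_; _*_; _∸_; _^_)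
open import Data.Fin.Subset using (Subset; ∣_∣)
open import Data.List using (List; length)
open import Data.List.Relation.Unary.All using (All)
open import Relation.Binary.PropositionalEquality using (_≡_)

open import Data.Bool using (Bool; true; false; _∧_; _xor_; if_then_else_)
open import Data.Bool.Properties using (T-≡; xor-same; ∧-identityʳ; ∧-zeroʳ; ∨-zeroʳ; ¬-not)
import Data.Bool.Properties as Bool
open import Data.Fin as Fin using (Fin; toℕ; fromℕ; fromℕ<)
open import Data.Fin.Properties using (toℕ-fromℕ; toℕ-fromℕ<)
open import Data.Fin.Subset using (⊤; _⊆_)
open import Data.Fin.Subset.Properties using (∣⊤∣≡n; p⊆q⇒∣p∣≤∣q∣)
open import Data.List using ([]; _∷_; map)
import Data.List.Relation.Unary.All as All
open import Data.Nat using (zero; suc; pred; z≤n; s≤s; z<s; _<_; _<ᵇ_; _≡ᵇ_; _≤?_; _<?_)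
open import Data.Nat.ListAction using (sum)
open import Data.Nat.Properties
open import Algebra.Properties.CommutativeSemigroup +-commutativeSemigroup
  using (interchange; xy∙z≈xz∙y; xy∙z≈yz∙x)
open import Data.Nat.Tactic.RingSolver using (solve-∀)
open import Data.Product using (_×_; _,_; proj₁; proj₂; ∃-syntax)
open import Data.Sum using (_⊎_; inj₁; inj₂)
open import Data.Vec.Properties using (lookup⇒[]=)
open import Data.Vec using ([]; _∷_; lookup)
open import Function using (_∘_; Equivalence)
open import Relation.Nullary using (yes; no; contradiction)
open import Relation.Binary.PropositionalEquality
  using (refl; sym; trans; cong; cong₂; subst; subst₂; module ≡-Reasoning)

𝟙 : Bool → ℕ
𝟙 true  = 1
𝟙 false = 0

𝟙-∧≤ˡ : ∀ a b → 𝟙 (a ∧ b) ≤ 𝟙 a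
𝟙-∧≤ˡ true  true  = ≤-refl
𝟙-∧≤ˡ true  false = z≤n
𝟙-∧≤ˡ false b     = z≤n

𝟙-∧≤ʳ : ∀ a b → 𝟙 (a ∧ b) ≤ 𝟙 b
𝟙-∧≤ʳ true  b = ≤-refl
𝟙-∧≤ʳ false b = z≤n

0<𝟙[∧]⇒≡trueˡ : ∀ {a b} → 0 < 𝟙 (a ∧ b) → a ≡ true
0<𝟙[∧]⇒≡trueˡ {true}  _  = refl
0<𝟙[∧]⇒≡trueˡ {false} ()

∑< : ℕ → (ℕ → ℕ) → ℕ
∑< zero    f = 0
∑< (suc k) f = ∑< k f + f k

syntax ∑< k (λ i → e) = ∑[ i < k ] e

∑-zero : ∀ k → ∑[ i < k ] 0 ≡ 0
∑-zero zero    = refl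
∑-zero (suc k) = trans (+-identityʳ _) (∑-zero k)

∑-+ : ∀ k (f g : ℕ → ℕ) → ∑[ i < k ] (f i + g i) ≡ ∑[ i < k ] f i + ∑[ i < k ] g i
∑-+ zero    f g = refl
∑-+ (suc k) f g = trans (cong (_+ (f k + g k)) (∑-+ k f g)) (interchange (∑< k f) (∑< k g) (f k) (g k))

∑-shift : ∀ k (f : ℕ → ℕ) → ∑[ i < suc k ] f i ≡ f 0 + ∑[ i < k ] f (suc i)
∑-shift zero    f = +-comm 0 (f 0)
∑-shift (suc k) f = trans (cong (_+ f (suc k)) (∑-shift k f)) (+-assoc (f 0) _ _)

∑-𝟙-∧ˡ : ∀ k b (x : ℕ → Bool) → ∑[ i < k ] 𝟙 (b ∧ x i) ≡ 𝟙 b * ∑[ i < k ] 𝟙 (x i)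
∑-𝟙-∧ˡ k true  x = sym (*-identityˡ _)
∑-𝟙-∧ˡ k false x = ∑-zero k

*≤∑ : ∀ k {a} {f : ℕ → ℕ} → (∀ {i} → i < k → a ≤ f i) → k * a ≤ ∑[ i < k ] f i
*≤∑ zero    _ = z≤n
*≤∑ (suc k) {a} {f} a≤f =
  subst (_≤ ∑< k f + f k) (+-comm (k * a) a) (+-mono-≤ (*≤∑ k (a≤f ∘ m<n⇒m<1+n)) (a≤f ≤-refl))

module _ {A : Set} where

  sum-map-+ : ∀ (xs : List A) f g → sum (map (λ x → f x + g x) xs) ≡ sum (map f xs) + sum (map g xs)
  sum-map-+ []       f g = refl
  sum-map-+ (x ∷ xs) f g = trans (cong (f x + g x +_) (sum-map-+ xs f g))
                                 (interchange (f x) (g x) (sum (map f xs)) (sum (map g xs)))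

  sum-map-*ˡ : ∀ (xs : List A) a f → sum (map (λ x → a * f x) xs) ≡ a * sum (map f xs)
  sum-map-*ˡ []       a f = sym (*-zeroʳ a)
  sum-map-*ˡ (x ∷ xs) a f = trans (cong (a * f x +_) (sum-map-*ˡ xs a f)) (sym (*-distribˡ-+ a (f x) _))

  sum-map-∑ : ∀ (xs : List A) k (t : A → ℕ → ℕ) →
    sum (map (λ x → ∑[ i < k ] t x i) xs) ≡ ∑[ i < k ] sum (map (λ x → t x i) xs)
  sum-map-∑ []       k t = sym (∑-zero k)
  sum-map-∑ (x ∷ xs) k t = trans (cong (∑< k (t x) +_) (sum-map-∑ xs k t))
                                 (sym (∑-+ k (t x) (λ i → sum (map (λ x → t x i) xs))))

  sum-map-≤ : ∀ {xs : List A} {f d} → All (λ x → f x ≤ d) xs → sum (map f xs) ≤ length xs * d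
  sum-map-≤ All.[]         = z≤n
  sum-map-≤ (fx≤d All.∷ h) = +-mono-≤ fx≤d (sum-map-≤ h)

mem : ∀ {n} → Subset n → ℕ → Bool
mem []      _       = false
mem (b ∷ X) zero    = b
mem (b ∷ X) (suc i) = mem X i

mem-toℕ : ∀ {n} (X : Subset n) (u : Fin n) → mem X (toℕ u) ≡ lookup X u
mem-toℕ (b ∷ X) Fin.zero    = refl
mem-toℕ (b ∷ X) (Fin.suc u) = mem-toℕ X u

∣p∣≡∑mem : ∀ {n} (X : Subset n) → ∣ X ∣ ≡ ∑[ i < n ] 𝟙 (mem X i)
∣p∣≡∑mem []                = refl
∣p∣≡∑mem {suc n} (true  ∷ X) = trans (cong suc (∣p∣≡∑mem X)) (sym (∑-shift n _))
∣p∣≡∑mem {suc n} (false ∷ X) = trans (∣p∣≡∑mem X) (sym (∑-shift n _))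

Reverses : ∀ {n} → List (Subset n) → (Fin n → Fin n → Bool) → Set
Reverses Xs a = ∀ u v → invertAll Xs a u v ≡ a v u

cover : ∀ {n} → List (Subset n) → ℕ → ℕ → ℕ
cover Xs i j = sum (map (λ X → 𝟙 (mem X i ∧ mem X j)) Xs)

invertAll-untouched : ∀ {n} (Xs : List (Subset n)) a u v →
  cover Xs (toℕ u) (toℕ v) ≡ 0 → invertAll Xs a u v ≡ a u v
invertAll-untouched []       a u v _ = refl
invertAll-untouched (X ∷ Xs) a u v h with mem X (toℕ u) ∧ mem X (toℕ v) in uv∈X
... | false = trans (invertAll-untouched Xs (invert X a) u v h)
                    (cong (λ b → if b then a v u else a u v) uv∉X)
  where
  uv∉X : lookup X u ∧ lookup X v ≡ false
  uv∉X = trans (sym (cong₂ _∧_ (mem-toℕ X u) (mem-toℕ X v))) uv∈X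

edge-covered : ∀ {n G} (O : Orientation n G) {Xs} → Reverses Xs (arc O) →
  ∀ {u v} → G u v ≡ true → 0 < cover Xs (toℕ u) (toℕ v)
edge-covered O {Xs} rev {u} {v} uv with cover Xs (toℕ u) (toℕ v) in none
... | suc _ = s≤s z≤n
... | zero  = contradiction (trans (sym (xor-same (arc O v u))) one-way) λ ()
  where
  fixed : arc O u v ≡ arc O v u
  fixed = trans (sym (invertAll-untouched Xs (arc O) u v none)) (rev u v)
  one-way : arc O v u xor arc O v u ≡ true
  one-way = subst (λ b → b xor arc O v u ≡ true) fixed (edge-one O u v uv)

2≤length : ∀ {n G} (O : Orientation n G) {Xs} → Fin n → (∀ u → ∃[ v ] G u v ≡ true) →
  Reverses Xs (arc O) → All (λ X → ∣ X ∣ < n) Xs → 2 ≤ length Xs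
2≤length O {[]} u₀ nbr rev _ with edge-covered O {[]} rev (proj₂ (nbr u₀))
... | ()
2≤length {n} O {X ∷ []} _ nbr rev (∣X∣<n All.∷ All.[]) =
  contradiction (subst (_≤ ∣ X ∣) (∣⊤∣≡n n) (p⊆q⇒∣p∣≤∣q∣ ⊤⊆X)) (<⇒≱ ∣X∣<n)
  where
  ⊤⊆X : ⊤ ⊆ X
  ⊤⊆X {u} _ = lookup⇒[]= u X (trans (sym (mem-toℕ X u))
    (0<𝟙[∧]⇒≡trueˡ (subst (0 <_) (+-identityʳ _) (edge-covered O {X ∷ []} rev (proj₂ (nbr u))))))
2≤length O {_ ∷ _ ∷ _} _ _ _ _ = s≤s (s≤s z≤n)

module Induced (x : ℕ → Bool) where

  count : ℕ → ℕ
  count k = ∑[ i < k ] 𝟙 (x i)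

  pathEdges : ℕ → ℕ
  pathEdges L = ∑[ i < L ] 𝟙 (x i ∧ x (suc i))

  cycleEdges : ℕ → ℕ
  cycleEdges L = pathEdges L + 𝟙 (x 0 ∧ x L)

  count-all : ∀ k → (∀ {i} → i < k → x i ≡ true) → count k ≡ k
  count-all zero    _   = refl
  count-all (suc k) all =
    trans (cong₂ _+_ (count-all k (all ∘ m<n⇒m<1+n)) (cong 𝟙 (all ≤-refl))) (+-comm k 1)

  pathEdges+last≤count : ∀ L → pathEdges L + 𝟙 (x L) ≤ count (suc L)
  pathEdges+last≤count zero    = ≤-refl
  pathEdges+last≤count (suc L) = +-monoˡ-≤ (𝟙 (x (suc L)))
    (≤-trans (+-monoʳ-≤ (pathEdges L) (𝟙-∧≤ˡ (x L) (x (suc L)))) (pathEdges+last≤count L))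

  pathEdges+first≤count : ∀ L → pathEdges L + 𝟙 (x 0) ≤ count (suc L)
  pathEdges+first≤count zero    = ≤-refl
  pathEdges+first≤count (suc L) = begin
    pathEdges L + 𝟙 (x L ∧ x (suc L)) + 𝟙 (x 0) ≡⟨ xy∙z≈xz∙y (pathEdges L) _ _ ⟩
    pathEdges L + 𝟙 (x 0) + 𝟙 (x L ∧ x (suc L)) ≤⟨ +-mono-≤ (pathEdges+first≤count L) (𝟙-∧≤ʳ (x L) _) ⟩
    count (suc (suc L))                         ∎
    where open ≤-Reasoning

  pathEdges≤pred-count : ∀ L → pathEdges L ≤ pred (count (suc L))
  pathEdges≤pred-count zero    = z≤n
  pathEdges≤pred-count (suc L) =
    extend (x L) (x (suc L)) (pathEdges+last≤count L) (pathEdges≤pred-count L)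
    where
    open ≤-Reasoning
    extend : ∀ {P C} a b → P + 𝟙 a ≤ C → P ≤ pred C → P + 𝟙 (a ∧ b) ≤ pred (C + 𝟙 b)
    extend {P} {C} a true  P+a≤C _ = begin
      P + 𝟙 (a ∧ true) ≡⟨ cong (λ b → P + 𝟙 b) (∧-identityʳ a) ⟩
      P + 𝟙 a          ≤⟨ P+a≤C ⟩
      C                ≡⟨ cong pred (+-comm 1 C) ⟩
      pred (C + 1)     ∎
    extend {P} {C} a false _ P≤C-1 = begin
      P + 𝟙 (a ∧ false) ≡⟨ cong (λ b → P + 𝟙 b) (∧-zeroʳ a) ⟩
      P + 0             ≡⟨ +-identityʳ P ⟩
      P                 ≤⟨ P≤C-1 ⟩
      pred C            ≡⟨ cong pred (+-identityʳ C) ⟨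
      pred (C + 0)      ∎

  -- A vertex outside the set separates 0 from L, so each end lies in its own component.
  pathEdges+ends≤count : ∀ {j} L → j ≤ L → x j ≡ false →
    pathEdges L + 𝟙 (x 0) + 𝟙 (x L) ≤ count (suc L)
  pathEdges+ends≤count zero z≤n x0 rewrite x0 = z≤n
  pathEdges+ends≤count (suc L) j≤1+L xj with m≤n⇒m<n∨m≡n j≤1+L
  ... | inj₁ (s≤s j≤L) = begin
    pathEdges L + 𝟙 (x L ∧ x (suc L)) + 𝟙 (x 0) + 𝟙 (x (suc L))
      ≤⟨ +-monoˡ-≤ _ (+-monoˡ-≤ _ (+-monoʳ-≤ (pathEdges L) (𝟙-∧≤ˡ (x L) _))) ⟩
    pathEdges L + 𝟙 (x L) + 𝟙 (x 0) + 𝟙 (x (suc L))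
      ≡⟨ cong (_+ 𝟙 (x (suc L))) (xy∙z≈xz∙y (pathEdges L) _ _) ⟩
    pathEdges L + 𝟙 (x 0) + 𝟙 (x L) + 𝟙 (x (suc L))
      ≤⟨ +-monoˡ-≤ _ (pathEdges+ends≤count L j≤L xj) ⟩
    count (suc (suc L)) ∎
    where open ≤-Reasoning
  ... | inj₂ refl =
    subst (λ b → pathEdges L + 𝟙 (x L ∧ b) + 𝟙 (x 0) + 𝟙 b ≤ count (suc L) + 𝟙 b)
          (sym xj) (close-gap {pathEdges L} (x L) (pathEdges+first≤count L))
    where
    open ≤-Reasoning
    close-gap : ∀ {P f C} a → P + f ≤ C → P + 𝟙 (a ∧ false) + f + 0 ≤ C + 0
    close-gap {P} {f} {C} a P+f≤C = begin
      P + 𝟙 (a ∧ false) + f + 0 ≡⟨ +-identityʳ _ ⟩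
      P + 𝟙 (a ∧ false) + f     ≡⟨ cong (λ b → P + 𝟙 b + f) (∧-zeroʳ a) ⟩
      P + 0 + f                 ≡⟨ cong (_+ f) (+-identityʳ P) ⟩
      P + f                     ≤⟨ P+f≤C ⟩
      C                         ≡⟨ +-identityʳ C ⟨
      C + 0                     ∎

  cycleEdges≤count : ∀ L → cycleEdges L ≤ count (suc L)
  cycleEdges≤count L =
    ≤-trans (+-monoʳ-≤ (pathEdges L) (𝟙-∧≤ʳ (x 0) (x L))) (pathEdges+last≤count L)

  cycleEdges≤pred-count : ∀ {j} L → j ≤ L → x j ≡ false → cycleEdges L ≤ pred (count (suc L))
  cycleEdges≤pred-count L j≤L xj = close (x 0 ∧ x L)
    (≤-trans (+-mono-≤ (+-monoʳ-≤ (pathEdges L) (𝟙-∧≤ˡ (x 0) (x L))) (𝟙-∧≤ʳ (x 0) (x L)))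
             (pathEdges+ends≤count L j≤L xj))
    (pathEdges≤pred-count L)
    where
    close : ∀ {P C} b → P + 𝟙 b + 𝟙 b ≤ C → P ≤ pred C → P + 𝟙 b ≤ pred C
    close {P} {C} true  P+2≤C _ = suc[m]≤n⇒m≤pred[n] (subst (_≤ C) (+-comm (P + 1) 1) P+2≤C)
    close {P} {C} false _ P≤C-1 = subst (_≤ pred C) (sym (+-identityʳ P)) P≤C-1

  cycleEdges≤pred-count⊎count≡ : ∀ L → cycleEdges L ≤ pred (count (suc L)) ⊎ count (suc L) ≡ suc L
  cycleEdges≤pred-count⊎count≡ L with anyUpTo? (λ j → x j Bool.≟ false) (suc L)
  ... | yes (j , s≤s j≤L , xj) = inj₁ (cycleEdges≤pred-count L j≤L xj)
  ... | no  no-gap = inj₂ (count-all (suc L) (λ i<m → ¬-not (λ xi → no-gap (_ , i<m , xi))))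

partial-rim-weight≤ : ∀ q a b c → 𝟙 a + 𝟙 b + c ≤ 3 + q →
  𝟙 a * c + 𝟙 b * c + q * pred c ≤ suc q ^ 2 + 1
partial-rim-weight≤ q a b c h =
  ≤-trans (mono (m+n≤o⇒m≤o∸n c (subst (_≤ 3 + q) (+-comm (𝟙 a + 𝟙 b) c) h))) (extremal a b)
  where
  mono : ∀ {c c′} → c ≤ c′ → 𝟙 a * c + 𝟙 b * c + q * pred c ≤ 𝟙 a * c′ + 𝟙 b * c′ + q * pred c′
  mono c≤c′ = +-mono-≤ (+-mono-≤ (*-monoʳ-≤ (𝟙 a) c≤c′) (*-monoʳ-≤ (𝟙 b) c≤c′))
                       (*-monoʳ-≤ q (pred-mono-≤ c≤c′))
  -- The ring solver does not support _^_, so suc q ^ 2 is written unfolded.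
  two-hubs : ∀ q → 1 * suc q + 1 * suc q + q * q ≡ suc q * (suc q * 1) + 1
  two-hubs = solve-∀
  one-hub : ∀ q → 1 * (2 + q) + q * suc q ≡ suc q * (suc q * 1) + 1
  one-hub = solve-∀
  no-hub : ∀ q → q * (2 + q) + 2 ≡ suc q * (suc q * 1) + 1
  no-hub = solve-∀
  extremal : ∀ a b → let c = 3 + q ∸ (𝟙 a + 𝟙 b) in 𝟙 a * c + 𝟙 b * c + q * pred c ≤ suc q ^ 2 + 1
  extremal true  true  = ≤-reflexive (two-hubs q)
  extremal true  false = ≤-reflexive (trans (cong (_+ q * suc q) (+-identityʳ (1 * (2 + q)))) (one-hub q))
  extremal false true  = ≤-reflexive (one-hub q)
  extremal false false = ≤-trans (m≤m+n (q * (2 + q)) 2) (≤-reflexive (no-hub q))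

whole-rim-weight≤ : ∀ q a b c e → q ≤ 2 → 3 + q ≤ c → 𝟙 a + 𝟙 b + c ≤ 3 + q → e ≤ c →
  𝟙 a * c + 𝟙 b * c + q * e ≤ suc q ^ 2 + 1
whole-rim-weight≤ q false false c e q≤2 _ c≤3+q e≤c =
  ≤-trans (*-monoʳ-≤ q (≤-trans e≤c c≤3+q)) (small q≤2)
  where
  small : ∀ {q} → q ≤ 2 → q * (3 + q) ≤ suc q ^ 2 + 1
  small z≤n             = z≤n
  small (s≤s z≤n)       = n≤1+n 4
  small (s≤s (s≤s z≤n)) = ≤-refl
whole-rim-weight≤ q true  b     c e _ 3+q≤c h _ =
  contradiction (≤-trans h (≤-trans 3+q≤c (m≤n+m c (𝟙 b)))) 1+n≰n
whole-rim-weight≤ q false true  c e _ 3+q≤c h _ = contradiction (≤-trans h 3+q≤c) 1+n≰n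

[2+q]*[3+q]≤[[1+q]^2+1]*2 : ∀ {q} → 2 ≤ q → (2 + q) * (3 + q) ≤ (suc q ^ 2 + 1) * 2
[2+q]*[3+q]≤[[1+q]^2+1]*2 {suc (suc r)} (s≤s (s≤s _)) =
  ≤-trans (m≤m+n _ (r * (3 + r))) (≤-reflexive (identity r))
  where
  identity : ∀ r → (4 + r) * (5 + r) + r * (3 + r) ≡ ((3 + r) * ((3 + r) * 1) + 1) * 2
  identity = solve-∀

<ᵇ-true : ∀ {m n} → m < n → (m <ᵇ n) ≡ true
<ᵇ-true m<n = Equivalence.to T-≡ (<⇒<ᵇ m<n)

<ᵇ-false : ∀ {m n} → n ≤ m → (m <ᵇ n) ≡ false
<ᵇ-false {m} {n} n≤m = ¬-not (λ m<ᵇn → <⇒≱ (<ᵇ⇒< m n (Equivalence.from T-≡ m<ᵇn)) n≤m)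

≡ᵇ-refl : ∀ i → (i ≡ᵇ i) ≡ true
≡ᵇ-refl i = Equivalence.to T-≡ (≡⇒≡ᵇ i i refl)

cycAdj-suc : ∀ m i → cycAdj m i (suc i) ≡ true
cycAdj-suc m i rewrite ≡ᵇ-refl i = refl

cycAdj-0-last : ∀ L → cycAdj (suc L) 0 L ≡ true
cycAdj-0-last L rewrite ≡ᵇ-refl L = ∨-zeroʳ (1 ≡ᵇ L)

DW-spoke : ∀ {m} (u v : Fin (2 + m)) → toℕ u < m → m ≤ toℕ v →
  DW (2 + m) u v ≡ true × DW (2 + m) v u ≡ true
DW-spoke u v u<m m≤v rewrite <ᵇ-true u<m | <ᵇ-false m≤v = refl , refl

DW-rim : ∀ {m} (u v : Fin (2 + m)) → toℕ u < m → toℕ v < m →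
  DW (2 + m) u v ≡ cycAdj m (toℕ u) (toℕ v)
DW-rim u v u<m v<m rewrite <ᵇ-true u<m | <ᵇ-true v<m = refl

DW-no-isolated : ∀ {L} (u : Fin (3 + L)) → ∃[ v ] DW (3 + L) u v ≡ true
DW-no-isolated {L} u with toℕ u <? suc L
... | yes u<m = fromℕ (2 + L) ,
  proj₁ (DW-spoke u (fromℕ (2 + L)) u<m (subst (suc L ≤_) (sym (toℕ-fromℕ (2 + L))) (n≤1+n _)))
... | no  u≮m = Fin.zero , proj₂ (DW-spoke Fin.zero u z<s (≮⇒≥ u≮m))

-- With n = 3 + L and p = 3 + q, the rim is 0, …, L and the hubs are 1 + L and 2 + L.
spokes : ∀ {n} → ℕ → ℕ → Subset n → ℕ
spokes L h X = ∑[ i < suc L ] 𝟙 (mem X h ∧ mem X i)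

weight : ∀ {n} → ℕ → ℕ → Subset n → ℕ
weight q L X = spokes L (suc L) X + spokes L (2 + L) X + q * Induced.cycleEdges (mem X) L

weight≤ : ∀ {q L} → q + 2 ≤ L → q ≤ 2 ⊎ 3 + q ≤ L →
  ∀ {X : Subset (3 + L)} → ∣ X ∣ ≤ 3 + q → weight q L X ≤ suc q ^ 2 + 1
weight≤ {q} {L} q+2≤L short∨long {X} ∣X∣≤p =
  subst (_≤ suc q ^ 2 + 1) (sym weight≡) (bound (cycleEdges≤pred-count⊎count≡ L) short∨long)
  where
  open Induced (mem X)
  a b : Bool
  a = mem X (suc L)
  b = mem X (2 + L)
  c e : ℕ
  c = count (suc L)
  e = cycleEdges L
  weight≡ : weight q L X ≡ 𝟙 a * c + 𝟙 b * c + q * e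
  weight≡ = cong₂ (λ s t → s + t + q * e) (∑-𝟙-∧ˡ (suc L) a (mem X)) (∑-𝟙-∧ˡ (suc L) b (mem X))
  size : 𝟙 a + 𝟙 b + c ≤ 3 + q
  size = subst (_≤ 3 + q) (trans (∣p∣≡∑mem X) (xy∙z≈yz∙x c (𝟙 a) (𝟙 b))) ∣X∣≤p
  bound : e ≤ pred c ⊎ c ≡ suc L → q ≤ 2 ⊎ 3 + q ≤ L → 𝟙 a * c + 𝟙 b * c + q * e ≤ suc q ^ 2 + 1
  bound (inj₁ e≤c-1) _ =
    ≤-trans (+-monoʳ-≤ (𝟙 a * c + 𝟙 b * c) (*-monoʳ-≤ q e≤c-1)) (partial-rim-weight≤ q a b c size)
  bound (inj₂ c≡1+L) (inj₁ q≤2) = whole-rim-weight≤ q a b c e q≤2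
    (subst₂ _≤_ (cong suc (+-comm q 2)) (sym c≡1+L) (s≤s q+2≤L)) size (cycleEdges≤count L)
  bound (inj₂ c≡1+L) (inj₂ 3+q≤L) =
    contradiction (≤-trans (s≤s 3+q≤L) (subst (_≤ 3 + q) c≡1+L (m+n≤o⇒n≤o (𝟙 a + 𝟙 b) size))) 1+n≰n

sum-map-weight : ∀ {n} q L (Xs : List (Subset n)) → sum (map (weight q L) Xs) ≡
  ∑[ i < suc L ] cover Xs (suc L) i + ∑[ i < suc L ] cover Xs (2 + L) i
  + q * (∑[ i < L ] cover Xs i (suc i) + cover Xs 0 L)
sum-map-weight {n} q L Xs = begin
  sum (map (weight q L) Xs)
    ≡⟨ sum-map-+ Xs (λ X → spokes L (suc L) X + spokes L (2 + L) X) (λ X → q * rim X) ⟩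
  sum (map (λ X → spokes L (suc L) X + spokes L (2 + L) X) Xs) + sum (map (λ X → q * rim X) Xs)
    ≡⟨ cong₂ _+_ (sum-map-+ Xs (spokes L (suc L)) (spokes L (2 + L))) (sum-map-*ˡ Xs q rim) ⟩
  sum (map (spokes L (suc L)) Xs) + sum (map (spokes L (2 + L)) Xs) + q * sum (map rim Xs)
    ≡⟨ cong₂ _+_ (cong₂ _+_ (sum-map-∑ Xs (suc L) _) (sum-map-∑ Xs (suc L) _)) (cong (q *_) rim-sum) ⟩
  ∑[ i < suc L ] cover Xs (suc L) i + ∑[ i < suc L ] cover Xs (2 + L) i
  + q * (∑[ i < L ] cover Xs i (suc i) + cover Xs 0 L) ∎
  where
  open ≡-Reasoning
  rim : Subset n → ℕ
  rim X = Induced.cycleEdges (mem X) L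
  rim-sum : sum (map rim Xs) ≡ ∑[ i < L ] cover Xs i (suc i) + cover Xs 0 L
  rim-sum = trans (sum-map-+ Xs (λ X → Induced.pathEdges (mem X) L) (λ X → 𝟙 (mem X 0 ∧ mem X L)))
                  (cong (_+ cover Xs 0 L) (sum-map-∑ Xs L _))

module _ {L} (O : Orientation (3 + L) (DW (3 + L))) {Xs : List (Subset (3 + L))}
         (rev : Reverses Xs (arc O)) where

  private
    covered : ∀ {i j} (i<n : i < 3 + L) (j<n : j < 3 + L) →
      DW (3 + L) (fromℕ< i<n) (fromℕ< j<n) ≡ true → 0 < cover Xs i j
    covered i<n j<n =
      subst₂ (λ i j → 0 < cover Xs i j) (toℕ-fromℕ< i<n) (toℕ-fromℕ< j<n) ∘ edge-covered O {Xs} rev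

    rim<n : ∀ {i} → i < suc L → i < 3 + L
    rim<n = m<n⇒m<1+n ∘ m<n⇒m<1+n

  spoke-covered : ∀ {h i} → suc L ≤ h → h < 3 + L → i < suc L → 0 < cover Xs h i
  spoke-covered m≤h h<n i<m = covered h<n (rim<n i<m) (proj₂ (DW-spoke _ _
    (subst (_< suc L) (sym (toℕ-fromℕ< (rim<n i<m))) i<m)
    (subst (suc L ≤_) (sym (toℕ-fromℕ< h<n)) m≤h)))

  rim-covered : ∀ {i j} → i < suc L → j < suc L → cycAdj (suc L) i j ≡ true → 0 < cover Xs i j
  rim-covered i<m j<m ij = covered (rim<n i<m) (rim<n j<m) (trans (DW-rim _ _
    (subst (_< suc L) (sym (toℕ-fromℕ< (rim<n i<m))) i<m)
    (subst (_< suc L) (sym (toℕ-fromℕ< (rim<n j<m))) j<m))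
    (subst₂ (λ i j → cycAdj (suc L) i j ≡ true)
            (sym (toℕ-fromℕ< (rim<n i<m))) (sym (toℕ-fromℕ< (rim<n j<m))) ij))

  sum-weight≥ : ∀ q → (2 + q) * suc L ≤ sum (map (weight q L) Xs)
  sum-weight≥ q = begin
    (2 + q) * suc L
      ≡⟨ identity q L ⟩
    suc L * 1 + suc L * 1 + q * (L * 1 + 1)
      ≤⟨ +-mono-≤ (+-mono-≤ first-hub second-hub) (*-monoʳ-≤ q rim) ⟩
    ∑[ i < suc L ] cover Xs (suc L) i + ∑[ i < suc L ] cover Xs (2 + L) i
    + q * (∑[ i < L ] cover Xs i (suc i) + cover Xs 0 L)
      ≡⟨ sum-map-weight q L Xs ⟨
    sum (map (weight q L) Xs) ∎
    where
    open ≤-Reasoning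
    identity : ∀ q L → (2 + q) * suc L ≡ suc L * 1 + suc L * 1 + q * (L * 1 + 1)
    identity = solve-∀
    first-hub : suc L * 1 ≤ ∑[ i < suc L ] cover Xs (suc L) i
    first-hub = *≤∑ (suc L) (spoke-covered ≤-refl (m<n⇒m<1+n (n<1+n (suc L))))
    second-hub : suc L * 1 ≤ ∑[ i < suc L ] cover Xs (2 + L) i
    second-hub = *≤∑ (suc L) (spoke-covered (n≤1+n (suc L)) (n<1+n (2 + L)))
    rim : L * 1 + 1 ≤ ∑[ i < L ] cover Xs i (suc i) + cover Xs 0 L
    rim = +-mono-≤ (*≤∑ L (λ {i} i<L → rim-covered (m<n⇒m<1+n i<L) (s≤s i<L) (cycAdj-suc (suc L) i)))
                   (rim-covered z<s ≤-refl (cycAdj-0-last L))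

  weight-argument : ∀ {q} → q + 2 ≤ L → q ≤ 2 ⊎ 3 + q ≤ L → All (λ X → ∣ X ∣ ≤ 3 + q) Xs →
    (2 + q) * suc L ≤ (suc q ^ 2 + 1) * length Xs
  weight-argument {q} q+2≤L short∨long small = begin
    (2 + q) * suc L             ≤⟨ sum-weight≥ q ⟩
    sum (map (weight q L) Xs)   ≤⟨ sum-map-≤ (All.map (λ {X} → weight≤ q+2≤L short∨long {X}) small) ⟩
    length Xs * (suc q ^ 2 + 1) ≡⟨ *-comm (length Xs) _ ⟩
    (suc q ^ 2 + 1) * length Xs ∎
    where open ≤-Reasoning

proposition40 : (p n : ℕ) → 3 ≤ p → p + 2 ≤ n →
    (O : Orientation n (DW n)) → (Xs : List (Subset n)) →
    All (λ X → ∣ X ∣ ≤ p) Xs →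
    (∀ u v → invertAll Xs (arc O) u v ≡ arc O v u) →
    (p ∸ 1) * (n ∸ 2) ≤ ((p ∸ 2) ^ 2 + 1) * length Xs
proposition40 (suc (suc (suc q))) (suc (suc (suc L))) (s≤s (s≤s (s≤s z≤n))) (s≤s (s≤s (s≤s q+2≤L)))
  O Xs small rev with q ≤? 2 | 3 + q ≤? L
... | yes q≤2 | _         = weight-argument O rev q+2≤L (inj₁ q≤2) small
... | no _    | yes 3+q≤L = weight-argument O rev q+2≤L (inj₂ 3+q≤L) small
... | no q≰2  | no 3+q≰L = begin
  (2 + q) * suc L             ≤⟨ *-monoʳ-≤ (2 + q) (≰⇒> 3+q≰L) ⟩
  (2 + q) * (3 + q)           ≤⟨ [2+q]*[3+q]≤[[1+q]^2+1]*2 (<⇒≤ (≰⇒> q≰2)) ⟩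
  (suc q ^ 2 + 1) * 2         ≤⟨ *-monoʳ-≤ (suc q ^ 2 + 1) (2≤length O {Xs} Fin.zero DW-no-isolated rev
                                   (All.map (λ ∣X∣≤p → ≤-<-trans ∣X∣≤p p<n) small)) ⟩
  (suc q ^ 2 + 1) * length Xs ∎
  where
  open ≤-Reasoning
  p<n : 3 + q < 3 + L
  p<n = +-monoʳ-< 3 (<-≤-trans (m<m+n q z<s) q+2≤L)
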